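{- There is an absolute constant $C_0$ such that the following holds. Let $G,G'$ be graphs and consider the Ehrenfeucht game on $(G,G')$. Suppose $x\in V(G)$ and its counterpart $x'\in V(G')$ have been selected such that $G$ contains a cycle through $x$ of length at most $k$ while $G'$ contains no cycle through $x'$ of length at most $k$. Then Spoiler can win in at most $\log_2k+C_0$ further moves, playing all the time inside $G$.
   Context: The Ehrenfeucht game on $(G,G')$: in each round Spoiler marks a vertex of one graph with the round number and Duplicator marks a vertex of the other graph with the same number; Duplicator wins if at the end the correspondence between equally marked vertices preserves equality and adjacency, otherwise Spoiler wins. "Spoiler can win in $m$ further moves" means he has a winning strategy when the game is extended by $m$ rounds. -}

module Defs where

open import Data.Nat using (ℕ; zero; suc; _≤_)
open import Data.Fin using (Fin; toℕ)
open import Data.Bool using (Bool; true; false)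
open import Data.Product using (Σ; ∃; _×_; _,_)
open import Data.Sum using (_⊎_)
open import Data.List using (List; _∷_)
open import Data.List.Membership.Propositional using (_∈_)
open import Relation.Binary.PropositionalEquality using (_≡_)
open import Relation.Nullary using (¬_)
open import Function.Bundles using (_⇔_)
open import Function.Definitions using (Injective)

record Graph : Set where
  field
    n     : ℕ
    adj   : Fin n → Fin n → Bool
    sym   : ∀ u v → adj u v ≡ adj v u
    irref : ∀ v → adj v v ≡ false

open Graph public

V : Graph → Set
V G = Fin (n G)

Adj : (G : Graph) → V G → V G → Set
Adj G u v = adj G u v ≡ true

CycSucc : (ℓ : ℕ) → Fin ℓ → Fin ℓ → Set
CycSucc ℓ i j = (suc (toℕ i) ≡ toℕ j) ⊎ (suc (toℕ i) ≡ ℓ × toℕ j ≡ 0)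

record CycleThrough (G : Graph) (x : V G) (ℓ : ℕ) : Set where
  field
    long   : 3 ≤ ℓ
    vert   : Fin ℓ → V G
    inj    : Injective _≡_ _≡_ vert
    closed : ∀ i j → CycSucc ℓ i j → Adj G (vert i) (vert j)
    thru   : ∃ λ i → vert i ≡ x

HasShortCycleThrough : (G : Graph) → V G → ℕ → Set
HasShortCycleThrough G x k = ∃ λ ℓ → ℓ ≤ k × CycleThrough G x ℓ

-- A position of the Ehrenfeucht game on (G , G'): the list of pairs
-- (vertex of G, vertex of G') marked with the same round number.
Position : Graph → Graph → Set
Position G G' = List (V G × V G')

-- Duplicator's winning condition: the correspondence preserves
-- equality and adjacency.
PartialIso : (G G' : Graph) → Position G G' → Set
PartialIso G G' p =
  ∀ a a' b b' → (a , a') ∈ p → (b , b') ∈ p →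
    ((a ≡ b) ⇔ (a' ≡ b')) × (adj G a b ≡ adj G' a' b')

SpoilerWinsInG : (G G' : Graph) → ℕ → Position G G' → Set
SpoilerWinsInG G G' zero    p = ¬ PartialIso G G' p
SpoilerWinsInG G G' (suc m) p =
  Σ (V G) λ v → (v' : V G') → SpoilerWinsInG G G' m ((v , v') ∷ p)

-- On the short cycle through x in G, the two neighbours s, e of x are distinct and joined
-- by a path of length d = ℓ - 2 avoiding x. Spoiler marks s and e. If Duplicator's answers
-- s', e' are joined by a walk of length ≤ d avoiding x', a shortest such walk closes up
-- through x' to a cycle of length ≤ ℓ ≤ k, so Duplicator has already lost. Otherwise
-- Spoiler keeps marking the midpoint of the current path: Duplicator's answer cannot be
-- joined (avoiding x') to both ends within the respective half lengths, which leaves one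
-- half in the same situation. After ⌊log₂ k⌋ + 1 halvings the path has length ≤ 1, a
-- connection that every partial isomorphism preserves; so C₀ = 3 suffices.
module Submission where

open import Defs
open import Data.Nat using (ℕ; _≤_; _+_)
open import Data.Nat.Logarithm using (⌊log₂_⌋)
open import Data.Product using (∃; _×_; _,_)
open import Data.List.Membership.Propositional using (_∈_)
open import Relation.Nullary using (¬_)

open import Data.Bool.Base using (true)
import Data.Bool.Properties as Bool
open import Data.Nat.Base
  using (zero; suc; _<_; _∸_; _^_; _%_; ⌊_/2⌋; ⌈_/2⌉; NonZero; z≤n; s≤s; s≤s⁻¹; z<s; s<s; s<s⁻¹)
open import Data.Nat.Properties
open import Data.Nat.DivMod using (_mod_; m%n<n; m<n⇒m%n≡m; [m+n]%n≡m%n; %-distribˡ-+; m%n%n≡m%n; n%n≡0)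
open import Data.Nat.Logarithm using (⌊log₂⌋-mono-≤; ⌊log₂[2^n]⌋≡n)
open import Data.Fin.Base using (toℕ; zero)
open import Data.Fin.Properties using (toℕ-injective; toℕ<n; toℕ-fromℕ<; any?) renaming (_≟_ to _≟ᶠ_)
open import Data.Product using (proj₁; proj₂)
open import Data.Sum using (inj₁; inj₂)
open import Data.List.Base using (_∷_)
open import Data.List.Relation.Unary.Any using (here; there)
open import Function.Base using (_∘_)
open import Function.Bundles using (Equivalence)
open import Relation.Nullary using (Dec; yes; no; ¬?; contradiction)
open import Relation.Nullary.Decidable using (_×-dec_; map′)
open import Relation.Binary.Definitions using (tri<; tri≈; tri>)
open import Relation.Binary.PropositionalEquality as ≡
  using (_≡_; _≢_; refl; trans; cong; subst; subst₂; module ≡-Reasoning)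

open ≡-Reasoning

n≤2^[1+⌊log₂n⌋] : ∀ n → n ≤ 2 ^ suc ⌊log₂ n ⌋
n≤2^[1+⌊log₂n⌋] n = ≮⇒≥ λ 2^[1+⌊log₂n⌋]<n →
  1+n≰n (subst (_≤ ⌊log₂ n ⌋) (⌊log₂[2^n]⌋≡n (suc ⌊log₂ n ⌋)) (⌊log₂⌋-mono-≤ (<⇒≤ 2^[1+⌊log₂n⌋]<n)))

n∸⌊n/2⌋≡⌈n/2⌉ : ∀ n → n ∸ ⌊ n /2⌋ ≡ ⌈ n /2⌉
n∸⌊n/2⌋≡⌈n/2⌉ n = trans (cong (_∸ ⌊ n /2⌋) (≡.sym (⌊n/2⌋+⌈n/2⌉≡n n))) (m+n∸m≡n ⌊ n /2⌋ ⌈ n /2⌉)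

⌈n/2⌉≤2^t : ∀ {n} t → n ≤ 2 ^ suc t → ⌈ n /2⌉ ≤ 2 ^ t
⌈n/2⌉≤2^t {n} t n≤2^[1+t] = ≤-trans (⌈n/2⌉-mono n≤2^[1+t]) (≤-reflexive ⌈2^[1+t]/2⌉≡2^t)
  where
  ⌈2^[1+t]/2⌉≡2^t : ⌈ 2 ^ suc t /2⌉ ≡ 2 ^ t
  ⌈2^[1+t]/2⌉≡2^t = begin
    ⌈ 2 ^ t + (2 ^ t + 0) /2⌉ ≡⟨ cong (λ m → ⌈ 2 ^ t + m /2⌉) (+-identityʳ (2 ^ t)) ⟩
    ⌈ 2 ^ t + 2 ^ t /2⌉       ≡⟨ n≡⌈n+n/2⌉ (2 ^ t) ⟨
    2 ^ t                     ∎

[m+n%o]%o≡[m+n]%o : ∀ m n o .{{_ : NonZero o}} → (m + n % o) % o ≡ (m + n) % o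
[m+n%o]%o≡[m+n]%o m n o = begin
  (m + n % o) % o         ≡⟨ %-distribˡ-+ m (n % o) o ⟩
  (m % o + n % o % o) % o ≡⟨ cong (λ r → (m % o + r) % o) (m%n%n≡m%n n o) ⟩
  (m % o + n % o) % o     ≡⟨ %-distribˡ-+ m n o ⟨
  (m + n) % o             ∎

+-cancelˡ-% : ∀ {m n k o} .{{_ : NonZero o}} → m ≤ o → (m + n) % o ≡ (m + k) % o → n % o ≡ k % o
+-cancelˡ-% {m} {n} {k} {o} m≤o eq = begin
  n % o                     ≡⟨ undo n ⟨
  (o ∸ m + (m + n) % o) % o ≡⟨ cong (λ r → (o ∸ m + r) % o) eq ⟩
  (o ∸ m + (m + k) % o) % o ≡⟨ undo k ⟩
  k % o                     ∎
  where
  undo : ∀ i → (o ∸ m + (m + i) % o) % o ≡ i % o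
  undo i = begin
    (o ∸ m + (m + i) % o) % o ≡⟨ [m+n%o]%o≡[m+n]%o (o ∸ m) (m + i) o ⟩
    (o ∸ m + (m + i)) % o     ≡⟨ cong (_% o) (+-assoc (o ∸ m) m i) ⟨
    (o ∸ m + m + i) % o       ≡⟨ cong (λ r → (r + i) % o) (m∸n+n≡m m≤o) ⟩
    (o + i) % o               ≡⟨ cong (_% o) (+-comm o i) ⟩
    (i + o) % o               ≡⟨ [m+n]%n≡m%n i o ⟩
    i % o                     ∎

CycSucc-mod : ∀ {ℓ} .{{_ : NonZero ℓ}} m → CycSucc ℓ (m mod ℓ) (suc m mod ℓ)
CycSucc-mod {ℓ} m rewrite toℕ-fromℕ< (m%n<n m ℓ) | toℕ-fromℕ< (m%n<n (suc m) ℓ)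
  with m≤n⇒m<n∨m≡n (m%n<n m ℓ)
... | inj₁ 1+m%ℓ<ℓ = inj₁ (trans (≡.sym (m<n⇒m%n≡m 1+m%ℓ<ℓ)) ([m+n%o]%o≡[m+n]%o 1 m ℓ))
... | inj₂ 1+m%ℓ≡ℓ = inj₂ (1+m%ℓ≡ℓ , (begin
  suc m % ℓ         ≡⟨ [m+n%o]%o≡[m+n]%o 1 m ℓ ⟨
  suc (m % ℓ) % ℓ   ≡⟨ cong (_% ℓ) 1+m%ℓ≡ℓ ⟩
  ℓ % ℓ             ≡⟨ n%n≡0 ℓ ⟩
  0                 ∎))

Adj⇒≢ : ∀ {H : Graph} {u v} → Adj H u v → u ≢ v
Adj⇒≢ {H} {u} u~u refl with () ← trans (≡.sym u~u) (irref H u)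

HasShortCycleThrough-mono : ∀ {H y k k′} → k ≤ k′ → HasShortCycleThrough H y k → HasShortCycleThrough H y k′
HasShortCycleThrough-mono k≤k′ (ℓ , ℓ≤k , cycle) = ℓ , ≤-trans ℓ≤k k≤k′ , cycle

mkCycleThrough : ∀ {H : Graph} {m} (g : ℕ → V H) → 2 ≤ m →
  (∀ {a b} → a < suc m → b < suc m → g a ≡ g b → a ≡ b) →
  (∀ i → i < m → Adj H (g i) (g (suc i))) → Adj H (g m) (g 0) →
  CycleThrough H (g 0) (suc m)
mkCycleThrough {H} {m} g 2≤m g-injective step close = record
  { long   = s≤s 2≤m
  ; vert   = g ∘ toℕ
  ; inj    = λ {a} {b} → toℕ-injective ∘ g-injective (toℕ<n a) (toℕ<n b)
  ; closed = closed
  ; thru   = zero , refl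
  }
  where
  closed : ∀ i j → CycSucc (suc m) i j → Adj H (g (toℕ i)) (g (toℕ j))
  closed i j (inj₁ 1+i≡j) =
    subst (Adj H (g (toℕ i)) ∘ g) 1+i≡j
          (step (toℕ i) (s<s⁻¹ (subst (_< suc m) (≡.sym 1+i≡j) (toℕ<n j))))
  closed i j (inj₂ (1+i≡1+m , j≡0)) =
    subst₂ (λ a b → Adj H (g a) (g b)) (≡.sym (suc-injective 1+i≡1+m)) (≡.sym j≡0) close

module Avoiding (H : Graph) (y : V H) where

  -- Only the vertices after the first one are required to differ from y.
  Walk : ℕ → V H → V H → Set
  Walk zero    u w = u ≡ w
  Walk (suc j) u w = ∃ λ z → Adj H u z × z ≢ y × Walk j z w

  walk? : ∀ j u w → Dec (Walk j u w)
  walk? zero    u w = u ≟ᶠ w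
  walk? (suc j) u w = any? λ z → (adj H u z Bool.≟ true) ×-dec ¬? (z ≟ᶠ y) ×-dec walk? j z w

  Within : ℕ → V H → V H → Set
  Within d u w = ∃ λ j → j ≤ d × Walk j u w

  within? : ∀ d u w → Dec (Within d u w)
  within? d u w = map′ (λ (j , j<1+d , e) → j , s≤s⁻¹ j<1+d , e) (λ (j , j≤d , e) → j , s≤s j≤d , e)
                       (anyUpTo? (λ j → walk? j u w) (suc d))

  Within-mono : ∀ {d d′ u w} → d ≤ d′ → Within d u w → Within d′ u w
  Within-mono d≤d′ (j , j≤d , e) = j , ≤-trans j≤d d≤d′ , e

  _++_ : ∀ {a b u v w} → Walk a u v → Walk b v w → Walk (a + b) u w
  _++_ {zero}  refl                e′ = e′
  _++_ {suc a} (z , u~z , z≢y , e) e′ = z , u~z , z≢y , e ++ e′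

  Within-trans : ∀ {a b u v w} → Within a u v → Within b v w → Within (a + b) u w
  Within-trans (i , i≤a , e) (j , j≤b , e′) = i + j , +-mono-≤ i≤a j≤b , e ++ e′

  vertex : ∀ {j u w} → Walk j u w → ℕ → V H
  vertex {u = u} _                 zero    = u
  vertex {zero}  {u}  _            (suc i) = u
  vertex {suc j} (_ , _ , _ , e)   (suc i) = vertex e i

  vertex-last : ∀ {j u w} (e : Walk j u w) → vertex e j ≡ w
  vertex-last {zero}  u≡w             = u≡w
  vertex-last {suc j} (_ , _ , _ , e) = vertex-last e

  vertex-adj : ∀ {j u w i} (e : Walk j u w) → i < j → Adj H (vertex e i) (vertex e (suc i))
  vertex-adj {suc j} {i = zero}  (_ , u~z , _ , _) _         = u~z
  vertex-adj {suc j} {i = suc i} (_ , _ , _ , e)   (s<s i<j) = vertex-adj e i<j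

  vertex-avoids : ∀ {j u w} (e : Walk j u w) → u ≢ y → ∀ i → vertex e i ≢ y
  vertex-avoids _                   u≢y zero    = u≢y
  vertex-avoids {zero}  _           u≢y (suc i) = u≢y
  vertex-avoids {suc j} (_ , _ , z≢y , e) _ (suc i) = vertex-avoids e z≢y i

  take : ∀ {j u w a} (e : Walk j u w) → a ≤ j → Walk a u (vertex e a)
  take {a = zero}  _                     _         = refl
  take {a = suc a} (z , u~z , z≢y , e) (s≤s a≤j) = z , u~z , z≢y , take e a≤j

  drop : ∀ {j u w b} (e : Walk j u w) → b ≤ j → Walk (j ∸ b) (vertex e b) w
  drop {b = zero}  e               _         = e
  drop {b = suc b} (_ , _ , _ , e) (s≤s b≤j) = drop e b≤j

  walk-along : ∀ {d} (P : ℕ → V H) → (∀ i → i < d → Adj H (P i) (P (suc i))) →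
               (∀ i → i < d → P (suc i) ≢ y) → Walk d (P 0) (P d)
  walk-along {zero}  P _   _     = refl
  walk-along {suc d} P adj avoid =
    P 1 , adj 0 z<s , avoid 0 z<s , walk-along (P ∘ suc) (λ i → adj (suc i) ∘ s<s) (λ i → avoid (suc i) ∘ s<s)

  Shortest : ℕ → V H → V H → Set
  Shortest j u w = ∀ {i} → i < j → ¬ Walk i u w

  shortest : ∀ d {u w} → Within d u w → ∃ λ j → j ≤ d × Walk j u w × Shortest j u w
  shortest zero          (zero , _ , e) = zero , z≤n , e , λ ()
  shortest (suc d) {u} {w} (j , j≤1+d , e) with within? d u w | m≤n⇒m<n∨m≡n j≤1+d
  ... | yes r  | _          = let i , i≤d , e′ , s = shortest d r in i , m≤n⇒m≤1+n i≤d , e′ , s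
  ... | no ¬r  | inj₁ j<1+d = contradiction (j , s≤s⁻¹ j<1+d , e) ¬r
  ... | no ¬r  | inj₂ refl  = suc d , ≤-refl , e , λ i<1+d e′ → ¬r (_ , s≤s⁻¹ i<1+d , e′)

  Shortest⇒vertex-≢ : ∀ {j u w a b} (e : Walk j u w) → Shortest j u w →
                      a < b → b ≤ j → vertex e a ≢ vertex e b
  Shortest⇒vertex-≢ {j} {a = a} {b} e shortest a<b b≤j eq =
    shortest a+[j∸b]<j (take e (≤-trans (<⇒≤ a<b) b≤j) ++ subst (λ v → Walk (j ∸ b) v _) (≡.sym eq) (drop e b≤j))
    where
    a+[j∸b]<j : a + (j ∸ b) < j
    a+[j∸b]<j = <-≤-trans (+-monoˡ-< (j ∸ b) a<b) (≤-reflexive (m+[n∸m]≡n b≤j))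

  Shortest⇒vertex-injective : ∀ {j u w a b} (e : Walk j u w) → Shortest j u w →
                              a ≤ j → b ≤ j → vertex e a ≡ vertex e b → a ≡ b
  Shortest⇒vertex-injective {a = a} {b} e s a≤j b≤j eq with <-cmp a b
  ... | tri< a<b _ _ = contradiction eq (Shortest⇒vertex-≢ e s a<b b≤j)
  ... | tri≈ _ a≡b _ = a≡b
  ... | tri> _ _ b<a = contradiction (≡.sym eq) (Shortest⇒vertex-≢ e s b<a a≤j)

  close-cycle : ∀ {j u w} (e : Walk j u w) → Shortest j u w →
                Adj H y u → Adj H w y → u ≢ w → CycleThrough H y (2 + j)
  close-cycle {zero}  refl _ _ _ u≢w = contradiction refl u≢w
  close-cycle {suc j} {u} {w} e s y~u w~y _ = mkCycleThrough g (s≤s (s≤s z≤n)) g-injective step close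
    where
    u≢y : u ≢ y
    u≢y = Adj⇒≢ {H} y~u ∘ ≡.sym

    g : ℕ → V H
    g zero    = y
    g (suc i) = vertex e i

    g-injective : ∀ {a b} → a < 3 + j → b < 3 + j → g a ≡ g b → a ≡ b
    g-injective {zero}  {zero}  _       _       _  = refl
    g-injective {zero}  {suc b} _       _       eq = contradiction (≡.sym eq) (vertex-avoids e u≢y b)
    g-injective {suc a} {zero}  _       _       eq = contradiction eq (vertex-avoids e u≢y a)
    g-injective {suc a} {suc b} (s<s a<) (s<s b<) eq =
      cong suc (Shortest⇒vertex-injective e s (s≤s⁻¹ a<) (s≤s⁻¹ b<) eq)

    step : ∀ i → i < 2 + j → Adj H (g i) (g (suc i))
    step zero    _        = y~u
    step (suc i) (s<s i<) = vertex-adj e i<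

    close : Adj H (g (2 + j)) (g 0)
    close = subst (λ v → Adj H v y) (≡.sym (vertex-last e)) w~y

  record Detour (d : ℕ) : Set where
    field
      start end : V H
      y~start   : Adj H y start
      end~y     : Adj H end y
      start≢end : start ≢ end
      path      : Within d start end

  Detour⇒HasShortCycleThrough : ∀ {d} → Detour d → HasShortCycleThrough H y (2 + d)
  Detour⇒HasShortCycleThrough {d} D with shortest d (Detour.path D)
  ... | j , j≤d , e , s = 2 + j , s≤s (s≤s j≤d) , close-cycle e s y~start end~y start≢end
    where open Detour D

module Rotation {H : Graph} {y : V H} {L : ℕ} (c : CycleThrough H y (3 + L)) where
  open CycleThrough c
  open Avoiding H y

  private
    ℓ = 3 + L
    i₀ = proj₁ thru

  around : ℕ → V H
  around j = vert ((toℕ i₀ + j) mod ℓ)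

  around-adj : ∀ j → Adj H (around j) (around (suc j))
  around-adj j = closed _ _ (subst (λ m → CycSucc ℓ ((toℕ i₀ + j) mod ℓ) (m mod ℓ))
                                   (≡.sym (+-suc (toℕ i₀) j)) (CycSucc-mod (toℕ i₀ + j)))

  around-injective : ∀ {a b} → a < ℓ → b < ℓ → around a ≡ around b → a ≡ b
  around-injective {a} {b} a<ℓ b<ℓ eq = begin
    a     ≡⟨ m<n⇒m%n≡m a<ℓ ⟨
    a % ℓ ≡⟨ +-cancelˡ-% (<⇒≤ (toℕ<n i₀)) [i₀+a]%ℓ≡[i₀+b]%ℓ ⟩
    b % ℓ ≡⟨ m<n⇒m%n≡m b<ℓ ⟩
    b     ∎
    where
    [i₀+a]%ℓ≡[i₀+b]%ℓ : (toℕ i₀ + a) % ℓ ≡ (toℕ i₀ + b) % ℓ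
    [i₀+a]%ℓ≡[i₀+b]%ℓ = trans (≡.sym (toℕ-fromℕ< _)) (trans (cong toℕ (inj eq)) (toℕ-fromℕ< _))

  around-≡-y : ∀ {j} → j % ℓ ≡ 0 → around j ≡ y
  around-≡-y {j} j%ℓ≡0 = trans (cong vert (toℕ-injective toℕ[i₀+j]≡toℕi₀)) (proj₂ thru)
    where
    toℕ[i₀+j]≡toℕi₀ : toℕ ((toℕ i₀ + j) mod ℓ) ≡ toℕ i₀
    toℕ[i₀+j]≡toℕi₀ = begin
      toℕ ((toℕ i₀ + j) mod ℓ) ≡⟨ toℕ-fromℕ< _ ⟩
      (toℕ i₀ + j) % ℓ         ≡⟨ [m+n%o]%o≡[m+n]%o (toℕ i₀) j ℓ ⟨
      (toℕ i₀ + j % ℓ) % ℓ     ≡⟨ cong (λ r → (toℕ i₀ + r) % ℓ) j%ℓ≡0 ⟩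
      (toℕ i₀ + 0) % ℓ         ≡⟨ cong (_% ℓ) (+-identityʳ (toℕ i₀)) ⟩
      toℕ i₀ % ℓ               ≡⟨ m<n⇒m%n≡m (toℕ<n i₀) ⟩
      toℕ i₀                   ∎

  cycle⇒detour : Detour (1 + L)
  cycle⇒detour = record
    { start     = around 1
    ; end       = around (2 + L)
    ; y~start   = subst (λ v → Adj H v (around 1)) (around-≡-y refl) (around-adj 0)
    ; end~y     = subst (Adj H (around (2 + L))) (around-≡-y (n%n≡0 ℓ)) (around-adj (2 + L))
    ; start≢end = λ eq → contradiction (around-injective (s≤s (s≤s z≤n)) ≤-refl eq) λ ()
    ; path      = 1 + L , ≤-refl , walk-along (around ∘ suc) (λ i _ → around-adj (suc i)) avoids-y
    }
    where
    avoids-y : ∀ i → i < 1 + L → around (2 + i) ≢ y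
    avoids-y i i<1+L eq with () ← around-injective (s≤s (s≤s i<1+L)) z<s (trans eq (≡.sym (around-≡-y refl)))

open Rotation using (cycle⇒detour)

PartialIso-∷⁻ : ∀ {G G' q p} → PartialIso G G' (q ∷ p) → PartialIso G G' p
PartialIso-∷⁻ iso a a' b b' a∈p b∈p = iso a a' b b' (there a∈p) (there b∈p)

¬PartialIso⇒SpoilerWins : ∀ {G G' p} → V G → ¬ PartialIso G G' p → ∀ m → SpoilerWinsInG G G' m p
¬PartialIso⇒SpoilerWins v ¬iso zero    = ¬iso
¬PartialIso⇒SpoilerWins {G} {G'} v ¬iso (suc m) =
  v , λ _ → ¬PartialIso⇒SpoilerWins v (¬iso ∘ PartialIso-∷⁻ {G} {G'}) m

module Transfer (G G' : Graph) {p : Position G G'} (iso : PartialIso G G' p)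
                {a b : V G} {a' b' : V G'} (a∈p : (a , a') ∈ p) (b∈p : (b , b') ∈ p) where

  ≡-transfer : a ≡ b → a' ≡ b'
  ≡-transfer = Equivalence.to (proj₁ (iso a a' b b' a∈p b∈p))

  ≢-transfer : a ≢ b → a' ≢ b'
  ≢-transfer a≢b = a≢b ∘ Equivalence.from (proj₁ (iso a a' b b' a∈p b∈p))

  Adj-transfer : Adj G a b → Adj G' a' b'
  Adj-transfer = trans (≡.sym (proj₂ (iso a a' b b' a∈p b∈p)))

module Play (G G' : Graph) (x : V G) (x' : V G') where
  open Transfer G G'
  module A  = Avoiding G x
  module A' = Avoiding G' x'

  short-walk-transfer : ∀ {p j u w u' w'} → PartialIso G G' p →
    (x , x') ∈ p → (u , u') ∈ p → (w , w') ∈ p → A.Walk j u w → j ≤ 1 → A'.Within j u' w'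
  short-walk-transfer {j = zero} iso _ u∈p w∈p u≡w _ = 0 , z≤n , ≡-transfer iso u∈p w∈p u≡w
  short-walk-transfer {j = suc zero} {w' = w'} iso x∈p u∈p w∈p (_ , u~w , w≢x , refl) _ =
    1 , ≤-refl , w' , Adj-transfer iso u∈p w∈p u~w , ≢-transfer iso w∈p x∈p w≢x , refl
  short-walk-transfer {j = suc (suc _)} _ _ _ _ _ (s≤s ())

  bisection : ∀ t {p j u w u' w'} → (x , x') ∈ p → (u , u') ∈ p → (w , w') ∈ p →
              A.Walk j u w → j ≤ 2 ^ t → ¬ A'.Within j u' w' → SpoilerWinsInG G G' t p
  bisection zero x∈p u∈p w∈p e j≤1 ¬r iso = ¬r (short-walk-transfer iso x∈p u∈p w∈p e j≤1)
  bisection (suc t) {p} {j} {u' = u'} {w'} x∈p u∈p w∈p e j≤2^[1+t] ¬r = A.vertex e h , respond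
    where
    h = ⌊ j /2⌋
    h≤j = ⌊n/2⌋≤n j

    respond : ∀ z' → SpoilerWinsInG G G' t ((A.vertex e h , z') ∷ p)
    respond z' with A'.within? h u' z'
    ... | yes r  = bisection t (there x∈p) (here refl) (there w∈p) (A.drop e h≤j)
                     (subst (_≤ 2 ^ t) (≡.sym (n∸⌊n/2⌋≡⌈n/2⌉ j)) (⌈n/2⌉≤2^t t j≤2^[1+t]))
                     (¬r ∘ subst (λ l → A'.Within l u' w') (m+[n∸m]≡n h≤j) ∘ A'.Within-trans r)
    ... | no ¬r′ = bisection t (there x∈p) (there u∈p) (here refl) (A.take e h≤j)
                     (≤-trans (⌊n/2⌋≤⌈n/2⌉ j) (⌈n/2⌉≤2^t t j≤2^[1+t])) ¬r′

  spoilerWins-on-detour : ∀ {t d p} → (x , x') ∈ p → A.Detour d →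
    ¬ HasShortCycleThrough G' x' (2 + d) → d ≤ 2 ^ t → SpoilerWinsInG G G' (2 + t) p
  spoilerWins-on-detour {t} {d} {p} x∈p D ¬short' d≤2^t = start , λ s' → end , λ e' → answer s' e'
    where
    open A.Detour D

    answer : ∀ s' e' → SpoilerWinsInG G G' t ((end , e') ∷ (start , s') ∷ p)
    answer s' e' with A'.within? d s' e'
    ... | yes r = ¬PartialIso⇒SpoilerWins x (λ iso → ¬short' (A'.Detour⇒HasShortCycleThrough (record
                    { y~start   = Adj-transfer iso x∈q s∈q y~start
                    ; end~y     = Adj-transfer iso e∈q x∈q end~y
                    ; start≢end = ≢-transfer iso s∈q e∈q start≢end
                    ; path      = r
                    }))) t
      where
      x∈q = there (there x∈p)
      s∈q = there (here refl)
      e∈q = here refl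
    ... | no ¬r = let j , j≤d , e = path in
                  bisection t (there (there x∈p)) (there (here refl)) (here refl)
                    e (≤-trans j≤d d≤2^t) (¬r ∘ A'.Within-mono j≤d)

open Play using (spoilerWins-on-detour)

lemma4 : ∃ λ (C₀ : ℕ) →
    (G G' : Graph) (k : ℕ) (p : Position G G') (x : V G) (x' : V G') →
    (x , x') ∈ p →
    HasShortCycleThrough G x k →
    ¬ HasShortCycleThrough G' x' k →
    ∃ λ (m : ℕ) → m ≤ ⌊log₂ k ⌋ + C₀ × SpoilerWinsInG G G' m p
lemma4 = 3 , λ where
  G G' k p x x' x∈p (3+L , 3+L≤k , cycle@record { long = s≤s (s≤s (s≤s _)) }) ¬short' →
    3 + ⌊log₂ k ⌋ , ≤-reflexive (+-comm 3 ⌊log₂ k ⌋) ,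
    spoilerWins-on-detour G G' x x' x∈p (cycle⇒detour cycle)
      (¬short' ∘ HasShortCycleThrough-mono 3+L≤k)
      (≤-trans (m≤n+m _ 2) (≤-trans 3+L≤k (n≤2^[1+⌊log₂n⌋] k)))
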